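{- Let $k\ge2$ and let $G$ be a strong $k$-chromatic-choosable graph with $n$ vertices and $e$ edges satisfying $e\le n(k-2)$. Then: (i) for every positive integer $p$, $G\vee K_p$ satisfies $|E(G\vee K_p)|\le|V(G\vee K_p)|(k+p-2)$; (ii) if $A,B\subseteq V(G)$ satisfy $A\cup B=V(G)$, $C=A\cap B$, $|A|,|B|>|C|$, $0<|C|\le3$ when $k$ is even and $0<|C|\le4$ when $k$ is odd, and $G'$ is formed from $G$ by adding new vertices $u$ and $s$ with $u$ adjacent to every vertex of $A$ and $s$ adjacent to every vertex of $B$, and $\chi(G')>k$, then $|E(G')|\le|V(G')|(k-1)$.
   Context: A list assignment gives each vertex a color set; a $k$-assignment has all lists of size $k$; $G$ is $L$-colorable if it has a proper coloring choosing each vertex's color from its list. A list assignment is constant if all lists are equal. $G$ is strong $k$-chromatic-choosable if $\chi(G)=k$ and every $(k-1)$-assignment $L$ for which $G$ is not $L$-colorable is constant. A strong $k$-chromatic-choosable graph with $n$ vertices and $e$ edges satisfies the edge condition if $e\le n(k-2)$. (Under the hypotheses, $G\vee K_p$ is strong $(k+p)$-chromatic-choosable and $G'$ is strong $(k+1)$-chromatic-choosable, so the conclusions say these graphs satisfy the edge condition.) $\vee$ denotes the join. -}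

module Defs where

open import Data.Nat using (ℕ; zero; suc; _+_; _*_; _∸_; _≤_; _<_)

open import Data.Bool using (Bool; true; false; not; _∧_; if_then_else_)
open import Data.Fin using (Fin; zero; suc; toℕ; splitAt; _≟_)

open import Data.Fin.Subset using (Subset; ⊤; _∪_; _∩_; ∣_∣; _∈_)
open import Data.Sum using (_⊎_; inj₁; inj₂)
open import Data.Product using (Σ; ∃; _×_; _,_)
open import Data.List using (List; length)
open import Data.List.Relation.Unary.Unique.Propositional using (Unique)
import Data.List.Membership.Propositional as LM
open import Relation.Nullary using (¬_; does; yes; no)
open import Relation.Binary.PropositionalEquality using (_≡_; _≢_; refl) renaming (sym to ≡-sym)

record Graph (n : ℕ) : Set where
  field
    adj    : Fin n → Fin n → Bool
    symm   : ∀ i j → adj i j ≡ adj j i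
    irrefl : ∀ i → adj i i ≡ false
open Graph public

sumFin : (n : ℕ) → (Fin n → ℕ) → ℕ
sumFin zero    f = 0
sumFin (suc n) f = f zero + sumFin n (λ i → f (suc i))

lessB : {n : ℕ} → Fin n → Fin n → Bool
lessB i j = Data.Nat._<ᵇ_ (toℕ i) (toℕ j)

edges : {n : ℕ} → Graph n → ℕ
edges {n} G = sumFin n (λ i → sumFin n (λ j →
  if adj G i j ∧ lessB i j then 1 else 0))

Colorable : {n : ℕ} → Graph n → ℕ → Set
Colorable {n} G m = Σ (Fin n → Fin m) λ f → ∀ i j → adj G i j ≡ true → f i ≢ f j

ChromaticNumber : {n : ℕ} → Graph n → ℕ → Set
ChromaticNumber G k = Colorable G k × (∀ m → m < k → ¬ Colorable G m)

ListAssignment : ℕ → Set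
ListAssignment n = Fin n → List ℕ

IsKAssignment : {n : ℕ} → ℕ → ListAssignment n → Set
IsKAssignment k L = ∀ v → Unique (L v) × length (L v) ≡ k

LColorable : {n : ℕ} → Graph n → ListAssignment n → Set
LColorable {n} G L = Σ (Fin n → ℕ) λ f →
  (∀ v → LM._∈_ (f v) (L v)) × (∀ i j → adj G i j ≡ true → f i ≢ f j)

Constant : {n : ℕ} → ListAssignment n → Set
Constant L = ∀ v w c → LM._∈_ c (L v) → LM._∈_ c (L w)

StrongChromaticChoosable : {n : ℕ} → Graph n → ℕ → Set
StrongChromaticChoosable {n} G k =
  ChromaticNumber G k ×
  (∀ (L : ListAssignment n) → IsKAssignment (k ∸ 1) L → ¬ LColorable G L → Constant L)

-- Join with a complete graph K_p: vertices Fin (n + p), the first n are G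

finNeqB : {p : ℕ} → Fin p → Fin p → Bool
finNeqB a b = not (does (a ≟ b))

finNeqB-sym : {p : ℕ} (a b : Fin p) → finNeqB a b ≡ finNeqB b a
finNeqB-sym a b with a ≟ b | b ≟ a
... | yes _ | yes _ = refl
... | no _  | no _  = refl
... | yes e | no ne = Data.Empty.⊥-elim (ne (≡-sym e))
  where import Data.Empty
... | no ne | yes e = Data.Empty.⊥-elim (ne (≡-sym e))
  where import Data.Empty

finNeqB-irr : {p : ℕ} (a : Fin p) → finNeqB a a ≡ false
finNeqB-irr a with a ≟ a
... | yes _ = refl
... | no ne = Data.Empty.⊥-elim (ne refl)
  where import Data.Empty

joinAdj' : {n p : ℕ} → Graph n → Fin n ⊎ Fin p → Fin n ⊎ Fin p → Bool
joinAdj' G (inj₁ a) (inj₁ b) = adj G a b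
joinAdj' G (inj₁ a) (inj₂ b) = true
joinAdj' G (inj₂ a) (inj₁ b) = true
joinAdj' G (inj₂ a) (inj₂ b) = finNeqB a b

joinAdj'-sym : {n p : ℕ} (G : Graph n) (x y : Fin n ⊎ Fin p) → joinAdj' G x y ≡ joinAdj' G y x
joinAdj'-sym G (inj₁ a) (inj₁ b) = Graph.symm G a b
joinAdj'-sym G (inj₁ a) (inj₂ b) = refl
joinAdj'-sym G (inj₂ a) (inj₁ b) = refl
joinAdj'-sym G (inj₂ a) (inj₂ b) = finNeqB-sym a b

joinAdj'-irr : {n p : ℕ} (G : Graph n) (x : Fin n ⊎ Fin p) → joinAdj' G x x ≡ false
joinAdj'-irr G (inj₁ a) = irrefl G a
joinAdj'-irr G (inj₂ a) = finNeqB-irr a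

joinK : {n : ℕ} → Graph n → (p : ℕ) → Graph (n + p)
joinK {n} G p = record
  { adj    = λ x y → joinAdj' G (splitAt n x) (splitAt n y)
  ; symm   = λ x y → joinAdj'-sym G (splitAt n x) (splitAt n y)
  ; irrefl = λ x → joinAdj'-irr G (splitAt n x)
  }

-- G' : add vertices u (= zero) and s (= suc zero); u ~ A, s ~ B.
-- Old vertex v of G is suc (suc v).

extAdj : {n : ℕ} → Graph n → Subset n → Subset n →
         Fin (suc (suc n)) → Fin (suc (suc n)) → Bool
extAdj G A B zero zero = false
extAdj G A B zero (suc zero) = false
extAdj G A B zero (suc (suc v)) = Data.Vec.lookup A v
  where import Data.Vec
extAdj G A B (suc zero) zero = false
extAdj G A B (suc zero) (suc zero) = false
extAdj G A B (suc zero) (suc (suc v)) = Data.Vec.lookup B v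
  where import Data.Vec
extAdj G A B (suc (suc v)) zero = Data.Vec.lookup A v
  where import Data.Vec
extAdj G A B (suc (suc v)) (suc zero) = Data.Vec.lookup B v
  where import Data.Vec
extAdj G A B (suc (suc v)) (suc (suc w)) = adj G v w

extAdj-sym : {n : ℕ} (G : Graph n) (A B : Subset n) (x y : Fin (suc (suc n))) →
             extAdj G A B x y ≡ extAdj G A B y x
extAdj-sym G A B zero zero = refl
extAdj-sym G A B zero (suc zero) = refl
extAdj-sym G A B zero (suc (suc v)) = refl
extAdj-sym G A B (suc zero) zero = refl
extAdj-sym G A B (suc zero) (suc zero) = refl
extAdj-sym G A B (suc zero) (suc (suc v)) = refl
extAdj-sym G A B (suc (suc v)) zero = refl
extAdj-sym G A B (suc (suc v)) (suc zero) = refl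
extAdj-sym G A B (suc (suc v)) (suc (suc w)) = Graph.symm G v w

extAdj-irr : {n : ℕ} (G : Graph n) (A B : Subset n) (x : Fin (suc (suc n))) →
             extAdj G A B x x ≡ false
extAdj-irr G A B zero = refl
extAdj-irr G A B (suc zero) = refl
extAdj-irr G A B (suc (suc v)) = irrefl G v

extend : {n : ℕ} → Graph n → Subset n → Subset n → Graph (suc (suc n))
extend G A B = record
  { adj = extAdj G A B ; symm = extAdj-sym G A B ; irrefl = extAdj-irr G A B }

Even : ℕ → Set
Even k = ∃ λ m → k ≡ 2 * m

module Submission where

open import Defs
open import Data.Bool using (true; false; _∧_; if_then_else_)
open import Data.Bool.Properties using (∧-zeroʳ; T-≡)
open import Data.Empty using (⊥-elim)
open import Data.Fin using (Fin; zero; suc; toℕ; _↑ˡ_; _↑ʳ_)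
open import Data.Fin.Properties using (toℕ-injective; splitAt-↑ˡ; splitAt-↑ʳ; toℕ-↑ˡ; toℕ-↑ʳ; toℕ<n)
open import Data.Fin.Subset using (Subset; ⊤; _∪_; _∩_; ∣_∣)
open import Data.Fin.Subset.Properties using (∣⊤∣≡n)
open import Data.Nat using (ℕ; zero; suc; _+_; _*_; _∸_; _≤_; _<_; z≤n; s≤s; _<ᵇ_; _≤?_)
open import Data.Nat.Properties
open import Data.Nat.Tactic.RingSolver using (solve-∀)
open import Data.Product using (_×_; _,_)
open import Data.Vec using ([]; _∷_; lookup)
open import Function using (_∘_; Equivalence)
open import Relation.Binary using (tri<; tri≈; tri>)
open import Relation.Binary.PropositionalEquality using (_≡_; refl; sym; trans; cong; cong₂)
open import Relation.Nullary using (¬_; yes; no)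

-- Both bounds are edge counts. Joining K_p adds at most n p + p² edges, and
-- (n + p)(k − 2 + p) exceeds n (k − 2) by at least that much. The graph G' has
-- |A| + |B| = n + |A ∩ B| ≤ n + 4 edges more than G, while (n + 2)(k − 1)
-- exceeds n (k − 2) by n + 2k − 2 ≥ n + 4 as soon as k ≥ 3. The case k = 2 is
-- impossible: n · 0 edges means no edges, so G would be 1-colourable.

sumFin-cong : ∀ n {f g : Fin n → ℕ} → (∀ i → f i ≡ g i) → sumFin n f ≡ sumFin n g
sumFin-cong zero    f≡g = refl
sumFin-cong (suc n) f≡g = cong₂ _+_ (f≡g zero) (sumFin-cong n (f≡g ∘ suc))

sumFin-mono : ∀ n {f g : Fin n → ℕ} → (∀ i → f i ≤ g i) → sumFin n f ≤ sumFin n g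
sumFin-mono zero    f≤g = z≤n
sumFin-mono (suc n) f≤g = +-mono-≤ (f≤g zero) (sumFin-mono n (f≤g ∘ suc))

sumFin-const : ∀ n c → sumFin n (λ _ → c) ≡ n * c
sumFin-const zero    c = refl
sumFin-const (suc n) c = cong (c +_) (sumFin-const n c)

sumFin-≤-const : ∀ n {f : Fin n → ℕ} {c} → (∀ i → f i ≤ c) → sumFin n f ≤ n * c
sumFin-≤-const n {c = c} f≤c = ≤-trans (sumFin-mono n f≤c) (≤-reflexive (sumFin-const n c))

sumFin-+ : ∀ n (f g : Fin n → ℕ) → sumFin n (λ i → f i + g i) ≡ sumFin n f + sumFin n g
sumFin-+ zero    f g = refl
sumFin-+ (suc n) f g = trans (cong (f zero + g zero +_) (sumFin-+ n (f ∘ suc) (g ∘ suc)))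
                             (interchange (f zero) (g zero) _ _)
  where
  interchange : ∀ a b c d → a + b + (c + d) ≡ a + c + (b + d)
  interchange = solve-∀

sumFin-↑ : ∀ m p (f : Fin (m + p) → ℕ) →
           sumFin (m + p) f ≡ sumFin m (f ∘ (_↑ˡ p)) + sumFin p (f ∘ (m ↑ʳ_))
sumFin-↑ zero    p f = refl
sumFin-↑ (suc m) p f = trans (cong (f zero +_) (sumFin-↑ m p (f ∘ suc)))
                             (sym (+-assoc (f zero) _ _))

term≤sumFin : ∀ n (f : Fin n → ℕ) i → f i ≤ sumFin n f
term≤sumFin (suc n) f zero    = m≤m+n _ _
term≤sumFin (suc n) f (suc i) = ≤-trans (term≤sumFin n (f ∘ suc) i) (m≤n+m _ _)

edgeIndicator : ∀ {n} → Graph n → Fin n → Fin n → ℕ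
edgeIndicator G i j = if adj G i j ∧ lessB i j then 1 else 0

edgeIndicator≤1 : ∀ {n} (G : Graph n) i j → edgeIndicator G i j ≤ 1
edgeIndicator≤1 G i j with adj G i j ∧ lessB i j
... | true  = ≤-refl
... | false = z≤n

edgeIndicator≤edges : ∀ {n} (G : Graph n) i j → edgeIndicator G i j ≤ edges G
edgeIndicator≤edges {n} G i j =
  ≤-trans (term≤sumFin n (edgeIndicator G i) j)
          (term≤sumFin n (λ i → sumFin n (edgeIndicator G i)) i)

adj⇒0<edges : ∀ {n} (G : Graph n) i j → adj G i j ≡ true → 0 < edges G
adj⇒0<edges G i j i~j with <-cmp (toℕ i) (toℕ j)
... | tri< i<j _ _ = ≤-trans (≤-reflexive (sym counted)) (edgeIndicator≤edges G i j)
  where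
  counted : edgeIndicator G i j ≡ 1
  counted rewrite i~j | Equivalence.to T-≡ (<⇒<ᵇ i<j) = refl
... | tri≈ _ i≡j _ with toℕ-injective i≡j
...   | refl with trans (sym i~j) (irrefl G i)
...     | ()
adj⇒0<edges G i j i~j | tri> _ _ j<i =
  ≤-trans (≤-reflexive (sym counted)) (edgeIndicator≤edges G j i)
  where
  counted : edgeIndicator G j i ≡ 1
  counted rewrite symm G j i | i~j | Equivalence.to T-≡ (<⇒<ᵇ j<i) = refl

χ≡2⇒0<edges : ∀ {n} (G : Graph n) → ChromaticNumber G 2 → 0 < edges G
χ≡2⇒0<edges {n} G (_ , χ≮) with edges G ≤? 0
... | no  e≰0 = ≰⇒> e≰0
... | yes e≤0 = ⊥-elim (χ≮ 1 ≤-refl ((λ _ → zero) , λ i j i~j _ → <⇒≱ (adj⇒0<edges G i j i~j) e≤0))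

≤⇒<ᵇ≡false : ∀ {m n} → n ≤ m → (m <ᵇ n) ≡ false
≤⇒<ᵇ≡false {m}     {zero}  _         = refl
≤⇒<ᵇ≡false {suc m} {suc n} (s≤s n≤m) = ≤⇒<ᵇ≡false n≤m

module _ {n : ℕ} (G : Graph n) (p : ℕ) where

  private
    row : Fin (n + p) → ℕ
    row x = sumFin (n + p) (edgeIndicator (joinK G p) x)

    rowG : Fin n → ℕ
    rowG a = sumFin n (edgeIndicator G a)

  edgeIndicator-joinK-old : ∀ a b →
    edgeIndicator (joinK G p) (a ↑ˡ p) (b ↑ˡ p) ≡ edgeIndicator G a b
  edgeIndicator-joinK-old a b
    rewrite splitAt-↑ˡ n a p | splitAt-↑ˡ n b p | toℕ-↑ˡ a p | toℕ-↑ˡ b p = refl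

  -- The vertices of K_p come after those of G, so an edge between the two
  -- parts is counted only in the row of its G-endpoint.
  edgeIndicator-joinK-new-old : ∀ a b → edgeIndicator (joinK G p) (n ↑ʳ a) (b ↑ˡ p) ≡ 0
  edgeIndicator-joinK-new-old a b
    rewrite splitAt-↑ʳ n p a | splitAt-↑ˡ n b p | toℕ-↑ʳ n a | toℕ-↑ˡ b p
          | ≤⇒<ᵇ≡false (≤-trans (<⇒≤ (toℕ<n b)) (m≤m+n n (toℕ a))) = refl

  private
    toK≤p : ∀ x → sumFin p (edgeIndicator (joinK G p) x ∘ (n ↑ʳ_)) ≤ p
    toK≤p x = ≤-trans (sumFin-≤-const p (λ j → edgeIndicator≤1 (joinK G p) x (n ↑ʳ j)))
                      (≤-reflexive (*-identityʳ p))

    oldRow≤ : ∀ a → row (a ↑ˡ p) ≤ rowG a + p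
    oldRow≤ a = begin
        row (a ↑ˡ p)
      ≡⟨ sumFin-↑ n p _ ⟩
        sumFin n (edgeIndicator (joinK G p) (a ↑ˡ p) ∘ (_↑ˡ p))
          + sumFin p (edgeIndicator (joinK G p) (a ↑ˡ p) ∘ (n ↑ʳ_))
      ≤⟨ +-mono-≤ (≤-reflexive (sumFin-cong n (edgeIndicator-joinK-old a))) (toK≤p (a ↑ˡ p)) ⟩
        rowG a + p ∎
      where open ≤-Reasoning

    newRow≤ : ∀ a → row (n ↑ʳ a) ≤ p
    newRow≤ a = begin
        row (n ↑ʳ a)
      ≡⟨ sumFin-↑ n p _ ⟩
        sumFin n (edgeIndicator (joinK G p) (n ↑ʳ a) ∘ (_↑ˡ p))
          + sumFin p (edgeIndicator (joinK G p) (n ↑ʳ a) ∘ (n ↑ʳ_))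
      ≡⟨ cong (_+ sumFin p (edgeIndicator (joinK G p) (n ↑ʳ a) ∘ (n ↑ʳ_)))
               (trans (sumFin-cong n (edgeIndicator-joinK-new-old a)) (sumFin-const n 0)) ⟩
        n * 0 + sumFin p (edgeIndicator (joinK G p) (n ↑ʳ a) ∘ (n ↑ʳ_))
      ≤⟨ +-mono-≤ (≤-reflexive (*-zeroʳ n)) (toK≤p (n ↑ʳ a)) ⟩
        p ∎
      where open ≤-Reasoning

  edges-joinK≤ : edges (joinK G p) ≤ edges G + n * p + p * p
  edges-joinK≤ = begin
      edges (joinK G p)
    ≡⟨ sumFin-↑ n p row ⟩
      sumFin n (row ∘ (_↑ˡ p)) + sumFin p (row ∘ (n ↑ʳ_))
    ≤⟨ +-mono-≤ (sumFin-mono n oldRow≤) (sumFin-≤-const p newRow≤) ⟩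
      sumFin n (λ a → rowG a + p) + p * p
    ≡⟨ cong (_+ p * p) (trans (sumFin-+ n rowG (λ _ → p)) (cong (edges G +_) (sumFin-const n p))) ⟩
      edges G + n * p + p * p ∎
    where open ≤-Reasoning

joinK-edge-condition : ∀ {n} (G : Graph n) d p →
  edges G ≤ n * d → edges (joinK G p) ≤ (n + p) * (d + p)
joinK-edge-condition {n} G d p e≤nd = begin
    edges (joinK G p)
  ≤⟨ edges-joinK≤ G p ⟩
    edges G + n * p + p * p
  ≤⟨ +-monoˡ-≤ (p * p) (+-monoˡ-≤ (n * p) e≤nd) ⟩
    n * d + n * p + p * p
  ≤⟨ m≤m+n _ (p * d) ⟩
    n * d + n * p + p * p + p * d
  ≡⟨ expand n p d ⟩
    (n + p) * (d + p) ∎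
  where
  open ≤-Reasoning
  expand : ∀ n p d → n * d + n * p + p * p + p * d ≡ (n + p) * (d + p)
  expand = solve-∀

∣∪∣+∣∩∣ : ∀ {n} (A B : Subset n) → ∣ A ∣ + ∣ B ∣ ≡ ∣ A ∪ B ∣ + ∣ A ∩ B ∣
∣∪∣+∣∩∣ []          []          = refl
∣∪∣+∣∩∣ (true ∷ A)  (true ∷ B)  =
  cong suc (trans (+-suc ∣ A ∣ ∣ B ∣) (trans (cong suc (∣∪∣+∣∩∣ A B)) (sym (+-suc _ _))))
∣∪∣+∣∩∣ (true ∷ A)  (false ∷ B) = cong suc (∣∪∣+∣∩∣ A B)
∣∪∣+∣∩∣ (false ∷ A) (true ∷ B)  = trans (+-suc ∣ A ∣ ∣ B ∣) (cong suc (∣∪∣+∣∩∣ A B))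
∣∪∣+∣∩∣ (false ∷ A) (false ∷ B) = ∣∪∣+∣∩∣ A B

-- The new vertices u, s are listed first, so the edges at u and s are counted
-- exactly in their rows, each of which is the indicator vector of A or of B.
edges-extend : ∀ {n} (G : Graph n) (A B : Subset n) →
               edges (extend G A B) ≡ ∣ A ∣ + (∣ B ∣ + edges G)
edges-extend {n} G A B =
  cong₂ _+_ (row≡size A)
    (cong₂ _+_ (row≡size B)
      (sumFin-cong n λ v → cong₂ _+_ (noBackEdge (lookup A v))
                                      (cong₂ _+_ (noBackEdge (lookup B v)) refl)))
  where
  row≡size : ∀ {m} (X : Subset m) →
             sumFin m (λ v → if lookup X v ∧ true then 1 else 0) ≡ ∣ X ∣
  row≡size []          = refl
  row≡size (true ∷ X)  = cong suc (row≡size X)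
  row≡size (false ∷ X) = row≡size X

  noBackEdge : ∀ b → (if b ∧ false then 1 else 0) ≡ 0
  noBackEdge b rewrite ∧-zeroʳ b = refl

extend-edge-condition : ∀ {n} (G : Graph n) d (A B : Subset n) →
  edges G ≤ n * d → A ∪ B ≡ ⊤ → ∣ A ∩ B ∣ ≤ 2 * (1 + d) →
  edges (extend G A B) ≤ (2 + n) * (1 + d)
extend-edge-condition {n} G d A B e≤nd A∪B≡⊤ c≤ = begin
    edges (extend G A B)
  ≡⟨ trans (edges-extend G A B) (sym (+-assoc ∣ A ∣ ∣ B ∣ (edges G))) ⟩
    ∣ A ∣ + ∣ B ∣ + edges G
  ≡⟨ cong (_+ edges G) (trans (∣∪∣+∣∩∣ A B) (cong (_+ ∣ A ∩ B ∣) (trans (cong ∣_∣ A∪B≡⊤) (∣⊤∣≡n n)))) ⟩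
    n + ∣ A ∩ B ∣ + edges G
  ≤⟨ +-mono-≤ (+-monoʳ-≤ n c≤) e≤nd ⟩
    n + 2 * (1 + d) + n * d
  ≡⟨ expand n d ⟩
    (2 + n) * (1 + d) ∎
  where
  open ≤-Reasoning
  expand : ∀ n d → n + 2 * (1 + d) + n * d ≡ (2 + n) * (1 + d)
  expand = solve-∀

≤3-if-even⇒≤4 : ∀ k c → (Even k → c ≤ 3) → (¬ Even k → c ≤ 4) → c ≤ 4
≤3-if-even⇒≤4 k c even⇒≤3 odd⇒≤4 with c ≤? 4
... | yes c≤4 = c≤4
... | no  c≰4 = odd⇒≤4 (λ ev → c≰4 (≤-trans (even⇒≤3 ev) (n≤1+n 3)))

proposition3p5 :
    (k n : ℕ) → 2 ≤ k → (G : Graph n) → StrongChromaticChoosable G k →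
    edges G ≤ n * (k ∸ 2) →
    ((p : ℕ) → 1 ≤ p → edges (joinK G p) ≤ (n + p) * (k + p ∸ 2))
    ×
    ((A B : Subset n) → A ∪ B ≡ ⊤ →
      ∣ A ∩ B ∣ < ∣ A ∣ → ∣ A ∩ B ∣ < ∣ B ∣ → 0 < ∣ A ∩ B ∣ →
      (Even k → ∣ A ∩ B ∣ ≤ 3) → (¬ Even k → ∣ A ∩ B ∣ ≤ 4) →
      ¬ Colorable (extend G A B) k →
      edges (extend G A B) ≤ suc (suc n) * (k ∸ 1))
proposition3p5 (suc (suc d)) n _ G (χ≡2+d , _) e≤nd =
  (λ p _ → joinK-edge-condition G d p e≤nd) ,
  λ A B A∪B≡⊤ _ _ _ even⇒≤3 odd⇒≤4 _ →
    extend-edge-condition G d A B e≤nd A∪B≡⊤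
      (≤-trans (≤3-if-even⇒≤4 _ _ even⇒≤3 odd⇒≤4) (*-monoʳ-≤ 2 (s≤s 0<d)))
  where
  0<d : 0 < d
  0<d = n≢0⇒n>0 λ { refl → <⇒≱ (χ≡2⇒0<edges G χ≡2+d) (≤-trans e≤nd (≤-reflexive (*-zeroʳ n))) }
proposition3p5 zero          _ ()        _ _ _
proposition3p5 (suc zero)    _ (s≤s ()) _ _ _
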